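{- Let $\mathcal{X}=(\Omega,S)$ be a homogeneous coherent configuration with maximum valency $k$ and indistinguishing number $c$, let $X=S_k$, and for $Y\subseteq X$ let $N(Y)=\{x\in X: x\sim y \text{ for all } y\in Y\}$. Then $|N(Y)|\ge |X|-c(k-1)|Y|$ for every $Y\subseteq X$.
   Context: A coherent configuration on a finite set $\Omega$ is a pair $(\Omega,S)$, $S$ a partition of $\Omega\times\Omega$ such that the diagonal $1_\Omega$ is a union of elements of $S$, $S$ is closed under $s\mapsto s^*=\{(\beta,\alpha):(\alpha,\beta)\in s\}$, and for $r,s,t\in S$ the number $c_{rs}^t=|\alpha r\cap\beta s^*|$ (where $\alpha r=\{\gamma:(\alpha,\gamma)\in r\}$) does not depend on $(\alpha,\beta)\in t$. It is homogeneous if $1_\Omega\in S$; $n_s=|\alpha s|$ is the valency, $S_k=\{s\in S:n_s=k\}$, and the indistinguishing number is $c=\max_{r\in S\setminus\{1_\Omega\}}\sum_{s\in S}c_{ss^*}^r$. For $r,s\in S$, $rs$ denotes the set of basis relations contained in $r\cdot s=\{(\alpha,\gamma):\exists\beta,(\alpha,\beta)\in r,(\beta,\gamma)\in s\}$. For $x,y\in X$, $x\sim y$ means $|x^*y|=k$. -}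

module Defs where

open import Data.Nat using (ℕ; zero; suc; _+_; _⊔_)
open import Data.Nat.Properties using () renaming (_≟_ to _ℕ≟_)
open import Data.Vec using (tabulate)
open import Data.Bool using (Bool; true; false; if_then_else_)
open import Data.Fin using (Fin; zero; suc)
open import Data.Fin.Properties using (_≟_; any?; all?)
open import Data.Fin.Subset using (Subset; _∈_)
open import Data.Fin.Subset.Properties using (_∈?_)
open import Data.Product using (Σ; ∃; _×_; _,_)
open import Relation.Nullary using (Dec; yes; no; ¬_)
open import Relation.Nullary.Decidable using (_×-dec_; _→-dec_; ⌊_⌋)
open import Relation.Unary using (Pred; Decidable)
open import Relation.Binary.PropositionalEquality using (_≡_)
open import Level using (0ℓ)

count : ∀ {m} {P : Pred (Fin m) 0ℓ} → Decidable P → ℕ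
count {zero}  P? = 0
count {suc m} P? = (if ⌊ P? zero ⌋ then 1 else 0) + count (λ i → P? (suc i))

sumF : ∀ {m} → (Fin m → ℕ) → ℕ
sumF {zero}  f = 0
sumF {suc m} f = f zero + sumF (λ i → f (suc i))

maxF : ∀ {m} → (Fin m → ℕ) → ℕ
maxF {zero}  f = 0
maxF {suc m} f = f zero ⊔ maxF (λ i → f (suc i))

-- A homogeneous coherent configuration on Ω = Fin (suc n) with m basis relations.
-- The partition S of Ω×Ω is given by a colouring  col : Ω → Ω → Fin m ;
-- the basis relation s ∈ Fin m is the colour class {(α,β) : col α β ≡ s}.
record HomCC (n m : ℕ) : Set where
  field
    col      : Fin (suc n) → Fin (suc n) → Fin m
    -- every colour class is nonempty (S is a partition, its blocks are nonempty)
    surj     : ∀ (s : Fin m) → ∃ λ α → ∃ λ β → col α β ≡ s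
    -- homogeneity: the diagonal 1_Ω is one of the basis relations, namely `one`
    one      : Fin m
    one-diag : ∀ α → col α α ≡ one
    one-only : ∀ α β → col α β ≡ one → α ≡ β
    star     : Fin m → Fin m
    star-col : ∀ α β → col β α ≡ star (col α β)

  inter : Fin m → Fin m → Fin (suc n) → Fin (suc n) → Fin (suc n) → Set
  inter r s α β γ = (col α γ ≡ r) × (col β γ ≡ star s)

  cnt : Fin m → Fin m → Fin (suc n) → Fin (suc n) → ℕ
  cnt r s α β = count (λ γ → (col α γ ≟ r) ×-dec (col β γ ≟ star s))

  field
    -- coherence: c_{rs}^t is independent of the choice of (α,β) ∈ t
    coherent : ∀ r s α β α′ β′ → col α β ≡ col α′ β′ → cnt r s α β ≡ cnt r s α′ β′

module _ {n m : ℕ} (X : HomCC n m) where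
  open HomCC X

  -- intersection number c_{rs}^t, evaluated at some (α,β) ∈ t (well defined by coherence)
  c[_,_]^_ : Fin m → Fin m → Fin m → ℕ
  c[ r , s ]^ t with surj t
  ... | α , β , _ = cnt r s α β

  -- valency n_s = |α s| (for α = the point 0 of Ω; independent of α by homogeneity)
  valency : Fin m → ℕ
  valency s = count (λ γ → col zero γ ≟ s)

  maxValency : ℕ
  maxValency = maxF valency

  indist : ℕ
  indist = maxF (λ r → if ⌊ r ≟ one ⌋ then 0 else sumF (λ s → c[ s , star s ]^ r))

  InProd : Fin m → Fin m → Fin m → Set
  InProd r s t = ∀ α β → col α β ≡ t → ∃ λ γ → (col α γ ≡ r) × (col γ β ≡ s)

  inProd? : ∀ r s t → Dec (InProd r s t)
  inProd? r s t = all? λ α → all? λ β →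
    (col α β ≟ t) →-dec any? (λ γ → (col α γ ≟ r) ×-dec (col γ β ≟ s))

  prodSize : Fin m → Fin m → ℕ
  prodSize r s = count (inProd? r s)

  _∼_ : Fin m → Fin m → Set
  x ∼ y = prodSize (star x) y ≡ maxValency

  Sk : Subset m
  Sk = tabulate (λ s → ⌊ valency s ℕ≟ maxValency ⌋)

  InN : Subset m → Fin m → Set
  InN Y x = (x ∈ Sk) × (∀ y → y ∈ Y → x ∼ y)

  inN? : ∀ Y → Decidable (InN Y)
  inN? Y x = (x ∈? Sk) ×-dec all? (λ y → (y ∈? Y) →-dec (prodSize (star x) y ℕ≟ maxValency))

  sizeN : Subset m → ℕ
  sizeN Y = count (inN? Y)

-- Fix y ∈ X and a point β with 0 ∈ βy, and call a point α confusing if col(α,δ) = col(α,0)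
-- for some δ ∈ βy other than 0. For each of these k − 1 points δ, the α with
-- col(α,δ) = col(α,0) number Σ_s c_{ss*}^{col(0,δ)} ≤ c, so at most c(k − 1) points are
-- confusing. If βx contains no confusing point, then for α₀ ∈ βx the map δ ↦ col(α₀,δ) is
-- injective on βy (by coherence, a collision would move to a confusing point of βx) and its
-- image is x*y, so |x*y| = k and x ∼ y. Hence at most c(k − 1) elements of X are not ∼ y,
-- and a union bound over y ∈ Y gives the inequality.

module Submission where

open import Defs
open import Data.Bool using (if_then_else_)
open import Data.Bool.Properties using (T-≡)
open import Data.Fin using (Fin; zero; suc)
open import Data.Fin.Properties using (_≟_; any?; suc-injective)
open import Data.Fin.Subset using (Subset; inside; outside; _⊆_; ∣_∣; _∈_)
open import Data.Fin.Subset.Properties using (_∈?_; drop-there)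
open import Data.Nat using (ℕ; zero; suc; _+_; _*_; _∸_; _≤_; _<_; z≤n; s≤s⁻¹)
open import Data.Nat.Properties
  using ( module ≤-Reasoning; +-*-semiring; *-identityˡ; *-comm; +-identityʳ
        ; ≤-trans; ≤-reflexive; ≤-antisym; +-mono-≤; +-monoʳ-≤; m≤m+n; m≤n+m; m≤m⊔n; m≤n⊔m)
  renaming (_≟_ to _ℕ≟_)
open import Data.Product using (∃; _×_; _,_; proj₁; proj₂; map₂)
open import Data.Vec using (_∷_; []; there)
open import Data.Vec.Properties using ([]=⇒lookup; lookup∘tabulate)
open import Function using (_∘_; _⇔_; mk⇔; Equivalence)
open import Level using (0ℓ)
open import Relation.Binary.PropositionalEquality
open import Relation.Nullary using (Dec; yes; no; ¬_; ¬?; contradiction)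
open import Relation.Nullary.Decidable
  using (_×-dec_; ⌊_⌋; isYes≗does; dec-false; toWitness; decidable-stable)
open import Relation.Unary using (Pred; Decidable)

open import Algebra.Properties.Semiring.Sum +-*-semiring
  using (sum-syntax; sum-cong-≗; sum-replicate-zero; ∑-comm; ∑-distrib-+; *-distribʳ-sum)

-- Counting over Fin

private
  variable
    A B : Set

indicator : Dec A → ℕ
indicator d = if ⌊ d ⌋ then 1 else 0

indicator-yes : (d : Dec A) → A → indicator d ≡ 1
indicator-yes (yes _) _ = refl
indicator-yes (no ¬a) a = contradiction a ¬a

indicator-no : (d : Dec A) → ¬ A → indicator d ≡ 0
indicator-no (yes a) ¬a = contradiction a ¬a
indicator-no (no _)  _  = refl

indicator-mono : (d : Dec A) (e : Dec B) → (A → B) → indicator d ≤ indicator e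
indicator-mono (yes a) e f = ≤-reflexive (sym (indicator-yes e (f a)))
indicator-mono (no _)  _ _ = z≤n

indicator-cong : (d : Dec A) (e : Dec B) → A ⇔ B → indicator d ≡ indicator e
indicator-cong d e A⇔B = ≤-antisym (indicator-mono d e to) (indicator-mono e d from)
  where open Equivalence A⇔B

sumF≡∑ : ∀ {m} (f : Fin m → ℕ) → sumF f ≡ ∑[ i < m ] f i
sumF≡∑ {zero}  f = refl
sumF≡∑ {suc m} f = cong (f zero +_) (sumF≡∑ (λ i → f (suc i)))

∑-mono-≤ : ∀ {m} {f g : Fin m → ℕ} → (∀ i → f i ≤ g i) → ∑[ i < m ] f i ≤ ∑[ i < m ] g i
∑-mono-≤ {zero}  f≤g = z≤n
∑-mono-≤ {suc m} f≤g = +-mono-≤ (f≤g zero) (∑-mono-≤ (λ i → f≤g (suc i)))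

term≤∑ : ∀ {m} (f : Fin m → ℕ) a → f a ≤ ∑[ i < m ] f i
term≤∑ f zero    = m≤m+n (f zero) _
term≤∑ f (suc a) = ≤-trans (term≤∑ (λ i → f (suc i)) a) (m≤n+m _ (f zero))

∑-single : ∀ {m} (f : Fin m → ℕ) a → (∀ i → i ≢ a → f i ≡ 0) → ∑[ i < m ] f i ≡ f a
∑-single {suc m} f zero f≡0 =
  trans (cong (f zero +_) (trans (sum-cong-≗ (λ i → f≡0 (suc i) λ ())) (sum-replicate-zero m)))
        (+-identityʳ (f zero))
∑-single {suc m} f (suc a) f≡0 =
  cong₂ _+_ (f≡0 zero λ ()) (∑-single (λ i → f (suc i)) a (λ i i≢a → f≡0 (suc i) (i≢a ∘ suc-injective)))

f≤maxF : ∀ {m} (f : Fin m → ℕ) a → f a ≤ maxF f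
f≤maxF f zero    = m≤m⊔n (f zero) _
f≤maxF f (suc a) = ≤-trans (f≤maxF (λ i → f (suc i)) a) (m≤n⊔m (f zero) _)

count≡∑ : ∀ {m} {P : Pred (Fin m) 0ℓ} (P? : Decidable P) → count P? ≡ ∑[ i < m ] indicator (P? i)
count≡∑ {zero}  P? = refl
count≡∑ {suc m} P? = cong (indicator (P? zero) +_) (count≡∑ (λ i → P? (suc i)))

module _ {m : ℕ} where

  count-mono : ∀ {P Q : Pred (Fin m) 0ℓ} (P? : Decidable P) (Q? : Decidable Q) →
    (∀ {i} → P i → Q i) → count P? ≤ count Q?
  count-mono P? Q? P⇒Q = subst₂ _≤_ (sym (count≡∑ P?)) (sym (count≡∑ Q?))
    (∑-mono-≤ λ i → indicator-mono (P? i) (Q? i) P⇒Q)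

  count-cong : ∀ {P Q : Pred (Fin m) 0ℓ} (P? : Decidable P) (Q? : Decidable Q) →
    (∀ i → P i ⇔ Q i) → count P? ≡ count Q?
  count-cong P? Q? P⇔Q = ≤-antisym (count-mono P? Q? (Equivalence.to (P⇔Q _)))
                                   (count-mono Q? P? (Equivalence.from (P⇔Q _)))

  count≡0 : ∀ {P : Pred (Fin m) 0ℓ} (P? : Decidable P) → (∀ i → ¬ P i) → count P? ≡ 0
  count≡0 P? ¬P = trans (count≡∑ P?)
    (trans (sum-cong-≗ (λ i → indicator-no (P? i) (¬P i))) (sum-replicate-zero m))

  ∃⇒0<count : ∀ {P : Pred (Fin m) 0ℓ} (P? : Decidable P) → ∃ P → 0 < count P?
  ∃⇒0<count P? (a , pa) = subst (1 ≤_) (sym (count≡∑ P?))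
    (≤-trans (≤-reflexive (sym (indicator-yes (P? a) pa))) (term≤∑ (λ i → indicator (P? i)) a))

  0<count⇒∃ : ∀ {P : Pred (Fin m) 0ℓ} (P? : Decidable P) → 0 < count P? → ∃ P
  0<count⇒∃ P? 0<count with any? P?
  ... | yes ∃P = ∃P
  ... | no ¬∃P = contradiction (subst (0 <_) (count≡0 P? λ i pi → ¬∃P (i , pi)) 0<count) λ ()

  count-split : ∀ {P Q : Pred (Fin m) 0ℓ} (P? : Decidable P) (Q? : Decidable Q) →
    count P? ≡ count (λ i → P? i ×-dec Q? i) + count (λ i → P? i ×-dec ¬? (Q? i))
  count-split {P} {Q} P? Q? = begin
    count P?
      ≡⟨ count≡∑ P? ⟩
    ∑[ i < m ] indicator (P? i)
      ≡⟨ sum-cong-≗ split ⟩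
    ∑[ i < m ] (indicator (P∧Q? i) + indicator (P∧¬Q? i))
      ≡⟨ ∑-distrib-+ (indicator ∘ P∧Q?) (indicator ∘ P∧¬Q?) ⟩
    ∑[ i < m ] indicator (P∧Q? i) + ∑[ i < m ] indicator (P∧¬Q? i)
      ≡⟨ cong₂ _+_ (count≡∑ P∧Q?) (count≡∑ P∧¬Q?) ⟨
    count P∧Q? + count P∧¬Q?
      ∎
    where
    open ≡-Reasoning
    P∧Q? : Decidable (λ i → P i × Q i)
    P∧Q? i = P? i ×-dec Q? i
    P∧¬Q? : Decidable (λ i → P i × ¬ Q i)
    P∧¬Q? i = P? i ×-dec ¬? (Q? i)
    split : ∀ i → indicator (P? i) ≡ indicator (P∧Q? i) + indicator (P∧¬Q? i)
    split i with P? i | Q? i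
    ... | yes _ | yes _ = refl
    ... | yes _ | no _  = refl
    ... | no _  | _     = refl

  count-single : ∀ {P : Pred (Fin m) 0ℓ} (P? : Decidable P) a →
    count (λ i → P? i ×-dec (i ≟ a)) ≡ indicator (P? a)
  count-single P? a = begin
    count (λ i → P? i ×-dec (i ≟ a))
      ≡⟨ count≡∑ (λ i → P? i ×-dec (i ≟ a)) ⟩
    ∑[ i < m ] indicator (P? i ×-dec (i ≟ a))
      ≡⟨ ∑-single _ a (λ i i≢a → indicator-no _ (i≢a ∘ proj₂)) ⟩
    indicator (P? a ×-dec (a ≟ a))
      ≡⟨ indicator-cong _ (P? a) (mk⇔ proj₁ (_, refl)) ⟩
    indicator (P? a)
      ∎
    where open ≡-Reasoning

  count-remove : ∀ {P : Pred (Fin m) 0ℓ} (P? : Decidable P) {a} → P a →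
    count P? ≡ suc (count (λ i → P? i ×-dec ¬? (i ≟ a)))
  count-remove P? {a} pa = trans (count-split P? (_≟ a))
    (cong (_+ count (λ i → P? i ×-dec ¬? (i ≟ a)))
          (trans (count-single P? a) (indicator-yes (P? a) pa)))

  unique⇒count≤1 : ∀ {P : Pred (Fin m) 0ℓ} (P? : Decidable P) →
    (∀ {a b} → P a → P b → a ≡ b) → count P? ≤ 1
  unique⇒count≤1 P? unique with any? P?
  ... | yes (a , pa) = ≤-reflexive (trans (count-remove P? pa)
                         (cong suc (count≡0 _ λ i (pi , i≢a) → i≢a (unique pi pa))))
  ... | no ¬∃P       = ≤-trans (≤-reflexive (count≡0 P? λ i pi → ¬∃P (i , pi))) z≤n

  count≤1⇒unique : ∀ {P : Pred (Fin m) 0ℓ} (P? : Decidable P) →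
    count P? ≤ 1 → ∀ {a b} → P a → P b → a ≡ b
  count≤1⇒unique P? count≤1 {a} {b} pa pb with a ≟ b
  ... | yes a≡b = a≡b
  ... | no  a≢b = contradiction
    (≤-trans (∃⇒0<count _ (b , pb , a≢b ∘ sym)) (s≤s⁻¹ (subst (_≤ 1) (count-remove P? pa) count≤1)))
    λ ()

count-fibres : ∀ {m k} {P : Pred (Fin m) 0ℓ} (P? : Decidable P) (f : Fin m → Fin k) →
  count P? ≡ ∑[ x < k ] count (λ i → P? i ×-dec (f i ≟ x))
count-fibres {m} {k} {P} P? f = begin
  count P?                                        ≡⟨ count≡∑ P? ⟩
  ∑[ i < m ] indicator (P? i)                     ≡⟨ sum-cong-≗ (sym ∘ fibre-of) ⟩
  ∑[ i < m ] ∑[ x < k ] indicator (fibre? x i)    ≡⟨ ∑-comm (λ i x → indicator (fibre? x i)) ⟩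
  ∑[ x < k ] ∑[ i < m ] indicator (fibre? x i)    ≡⟨ sum-cong-≗ (count≡∑ ∘ fibre?) ⟨
  ∑[ x < k ] count (fibre? x)                     ∎
  where
  open ≡-Reasoning
  fibre? : ∀ x → Decidable (λ i → P i × f i ≡ x)
  fibre? x i = P? i ×-dec (f i ≟ x)
  fibre-of : ∀ i → ∑[ x < k ] indicator (fibre? x i) ≡ indicator (P? i)
  fibre-of i = trans (∑-single _ (f i) (λ x x≢fi → indicator-no _ (x≢fi ∘ sym ∘ proj₂)))
                     (indicator-cong _ (P? i) (mk⇔ proj₁ (_, refl)))

count-image : ∀ {m k} {P : Pred (Fin m) 0ℓ} (P? : Decidable P) (f : Fin m → Fin k) →
  (∀ {a b} → P a → P b → f a ≡ f b → a ≡ b) →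
  count (λ x → any? λ i → P? i ×-dec (f i ≟ x)) ≡ count P?
count-image P? f injective =
  trans (count≡∑ (λ x → any? λ i → P? i ×-dec (f i ≟ x)))
        (trans (sum-cong-≗ fibre-size) (sym (count-fibres P? f)))
  where
  fibre-size : ∀ x → indicator (any? λ i → P? i ×-dec (f i ≟ x)) ≡ count (λ i → P? i ×-dec (f i ≟ x))
  fibre-size x with any? (λ i → P? i ×-dec (f i ≟ x))
  ... | yes ∃i = ≤-antisym (∃⇒0<count (λ i → P? i ×-dec (f i ≟ x)) ∃i)
                   (unique⇒count≤1 (λ i → P? i ×-dec (f i ≟ x))
                     λ (pa , fa) (pb , fb) → injective pa pb (trans fa (sym fb)))
  ... | no ¬∃i = sym (count≡0 _ λ i pi → ¬∃i (i , pi))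

count-≤-cover : ∀ {m k} {P : Pred (Fin k) 0ℓ} {Q : Pred (Fin m) 0ℓ}
  (P? : Decidable P) (Q? : Decidable Q) (f : Fin m → Fin k) →
  (∀ {x} → P x → ∃ λ i → Q i × f i ≡ x) → count P? ≤ count Q?
count-≤-cover P? Q? f cover = subst₂ _≤_ (sym (count≡∑ P?)) (sym (count-fibres Q? f))
  (∑-mono-≤ fibre-inhabited)
  where
  fibre-inhabited : ∀ x → indicator (P? x) ≤ count (λ i → Q? i ×-dec (f i ≟ x))
  fibre-inhabited x with P? x
  ... | yes px = ∃⇒0<count _ (cover px)
  ... | no  _  = z≤n

count-⋃≤ : ∀ {m k} {P : Pred (Fin k) 0ℓ} {R : Fin k → Pred (Fin m) 0ℓ}
  (P? : Decidable P) (R? : ∀ j → Decidable (R j)) {b} →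
  (∀ {j} → P j → count (R? j) ≤ b) →
  count (λ i → any? λ j → P? j ×-dec R? j i) ≤ count P? * b
count-⋃≤ {m} {k} P? R? {b} bounded = begin
  count (λ i → any? λ j → P? j ×-dec R? j i)
    ≡⟨ count≡∑ (λ i → any? λ j → P? j ×-dec R? j i) ⟩
  ∑[ i < m ] indicator (any? λ j → P? j ×-dec R? j i)
    ≤⟨ ∑-mono-≤ union-bound ⟩
  ∑[ i < m ] ∑[ j < k ] indicator (P? j ×-dec R? j i)
    ≡⟨ ∑-comm (λ i j → indicator (P? j ×-dec R? j i)) ⟩
  ∑[ j < k ] ∑[ i < m ] indicator (P? j ×-dec R? j i)
    ≤⟨ ∑-mono-≤ part-bound ⟩
  ∑[ j < k ] (indicator (P? j) * b)
    ≡⟨ *-distribʳ-sum b (λ j → indicator (P? j)) ⟨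
  (∑[ j < k ] indicator (P? j)) * b
    ≡⟨ cong (_* b) (count≡∑ P?) ⟨
  count P? * b
    ∎
  where
  open ≤-Reasoning
  union-bound : ∀ i →
    indicator (any? λ j → P? j ×-dec R? j i) ≤ ∑[ j < k ] indicator (P? j ×-dec R? j i)
  union-bound i with any? (λ j → P? j ×-dec R? j i)
  ... | yes (j , pr) = ≤-trans (≤-reflexive (sym (indicator-yes (P? j ×-dec R? j i) pr)))
                               (term≤∑ (λ j → indicator (P? j ×-dec R? j i)) j)
  ... | no _         = z≤n
  part-bound : ∀ j → ∑[ i < m ] indicator (P? j ×-dec R? j i) ≤ indicator (P? j) * b
  part-bound j with P? j
  ... | yes pj = begin
    ∑[ i < m ] indicator (yes pj ×-dec R? j i)
      ≡⟨ sum-cong-≗ (λ i → indicator-cong _ (R? j i) (mk⇔ proj₂ (pj ,_))) ⟩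
    ∑[ i < m ] indicator (R? j i)
      ≡⟨ count≡∑ (R? j) ⟨
    count (R? j)
      ≤⟨ bounded pj ⟩
    b
      ≡⟨ *-identityˡ b ⟨
    1 * b
      ∎
  ... | no ¬pj = ≤-reflexive (trans (sum-cong-≗ (λ i → indicator-no (no ¬pj ×-dec R? j i) (¬pj ∘ proj₁)))
                                    (sum-replicate-zero m))

∣p∣≡count : ∀ {m} (p : Subset m) → ∣ p ∣ ≡ count (_∈? p)
∣p∣≡count []            = refl
∣p∣≡count (inside ∷ p)  = cong suc (trans (∣p∣≡count p)
  (count-cong (_∈? p) (λ i → suc i ∈? (inside ∷ p)) λ _ → mk⇔ there drop-there))
∣p∣≡count (outside ∷ p) = trans (∣p∣≡count p)
  (count-cong (_∈? p) (λ i → suc i ∈? (outside ∷ p)) λ _ → mk⇔ there drop-there)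

-- Homogeneous coherent configurations

module _ {n m : ℕ} (𝒳 : HomCC n m) where
  open HomCC 𝒳

  Point : Set
  Point = Fin (suc n)

  star-involutive : ∀ s → star (star s) ≡ s
  star-involutive s with surj s
  ... | α , β , refl = sym (trans (star-col β α) (cong star (star-col α β)))

  col-swap : ∀ {α β s} → col α β ≡ s → col β α ≡ star s
  col-swap {α} {β} refl = star-col α β

  col-unswap : ∀ {α β s} → col β α ≡ star s → col α β ≡ s
  col-unswap {s = s} e = trans (col-swap e) (star-involutive s)

  col-diagonal : ∀ α β → col α α ≡ col β β
  col-diagonal α β = trans (one-diag α) (sym (one-diag β))

  -- Kept opaque: unfolding its witness search makes type checking anything that mentions
  -- the resulting point prohibitively slow.
  opaque
    coherent-∃ : ∀ {α β α′ β′ γ r u} → col α β ≡ col α′ β′ → col α γ ≡ r → col β γ ≡ u →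
      ∃ λ γ′ → col α′ γ′ ≡ r × col β′ γ′ ≡ u
    coherent-∃ {α} {β} {α′} {β′} {γ} {r} {u} same αγ βγ =
      map₂ (map₂ (λ e → trans e (star-involutive u)))
        (0<count⇒∃ (inter? α′ β′) (subst (0 <_) (coherent r (star u) α β α′ β′ same)
          (∃⇒0<count (inter? α β) (γ , αγ , trans βγ (sym (star-involutive u))))))
      where
      inter? : ∀ α β → Decidable (λ γ → col α γ ≡ r × col β γ ≡ star (star u))
      inter? α β γ = (col α γ ≟ r) ×-dec (col β γ ≟ star (star u))

  ∃-out : ∀ s β → ∃ λ α → col β α ≡ s
  ∃-out s β with surj s
  ... | a , b , ab = map₂ proj₁ (coherent-∃ (col-diagonal a β) ab ab)

  ∃-in : ∀ s δ → ∃ λ β → col β δ ≡ s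
  ∃-in s δ = map₂ col-unswap (∃-out (star s) δ)

  valency-at : ∀ β s → count (λ γ → col β γ ≟ s) ≡ valency 𝒳 s
  valency-at β s = begin
    count (λ γ → col β γ ≟ s)   ≡⟨ out≡cnt β ⟩
    cnt s (star s) β β          ≡⟨ coherent s (star s) β β zero zero (col-diagonal β zero) ⟩
    cnt s (star s) zero zero    ≡⟨ out≡cnt zero ⟨
    valency 𝒳 s                 ∎
    where
    open ≡-Reasoning
    out≡cnt : ∀ α → count (λ γ → col α γ ≟ s) ≡ cnt s (star s) α α
    out≡cnt α = count-cong (λ γ → col α γ ≟ s) (λ γ → (col α γ ≟ s) ×-dec (col α γ ≟ star (star s)))
      λ γ → mk⇔ (λ e → e , trans e (sym (star-involutive s))) proj₁

  cnt≡c : ∀ r s α β → cnt r s α β ≡ c[_,_]^_ 𝒳 r s (col α β)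
  cnt≡c r s α β with surj (col α β)
  ... | a , b , ab = coherent r s α β a b (sym ab)

  nondiagonal≤indist : ∀ {u} → u ≢ one → sumF (λ s → c[_,_]^_ 𝒳 s (star s) u) ≤ indist 𝒳
  nondiagonal≤indist {u} u≢one = subst (_≤ indist 𝒳) off-diagonal (f≤maxF term u)
    where
    Σc : Fin m → ℕ
    Σc r = sumF (λ s → c[_,_]^_ 𝒳 s (star s) r)
    term : Fin m → ℕ
    term r = if ⌊ r ≟ one ⌋ then 0 else Σc r
    off-diagonal : term u ≡ Σc u
    off-diagonal = cong (λ b → if b then 0 else Σc u)
                        (trans (isYes≗does (u ≟ one)) (dec-false (u ≟ one) u≢one))

  confusions≤indist : ∀ {δ δ′} → δ ≢ δ′ → count (λ α → col α δ′ ≟ col α δ) ≤ indist 𝒳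
  confusions≤indist {δ} {δ′} δ≢δ′ = begin
    count (λ α → col α δ′ ≟ col α δ)
      ≡⟨ count-fibres (λ α → col α δ′ ≟ col α δ) (col δ) ⟩
    ∑[ s < m ] count (confused-via? s)
      ≡⟨ sum-cong-≗ (λ s → count-cong (confused-via? s) (inter? s) (same-view s)) ⟩
    ∑[ s < m ] cnt s (star s) δ δ′
      ≡⟨ sum-cong-≗ (λ s → cnt≡c s (star s) δ δ′) ⟩
    ∑[ s < m ] c[_,_]^_ 𝒳 s (star s) (col δ δ′)
      ≡⟨ sumF≡∑ (λ s → c[_,_]^_ 𝒳 s (star s) (col δ δ′)) ⟨
    sumF (λ s → c[_,_]^_ 𝒳 s (star s) (col δ δ′))
      ≤⟨ nondiagonal≤indist (δ≢δ′ ∘ one-only δ δ′) ⟩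
    indist 𝒳
      ∎
    where
    open ≤-Reasoning
    confused-via? : ∀ s → Decidable (λ α → col α δ′ ≡ col α δ × col δ α ≡ s)
    confused-via? s α = (col α δ′ ≟ col α δ) ×-dec (col δ α ≟ s)
    inter? : ∀ s → Decidable (λ γ → col δ γ ≡ s × col δ′ γ ≡ star (star s))
    inter? s γ = (col δ γ ≟ s) ×-dec (col δ′ γ ≟ star (star s))
    same-view : ∀ s γ → (col γ δ′ ≡ col γ δ × col δ γ ≡ s) ⇔ (col δ γ ≡ s × col δ′ γ ≡ star (star s))
    same-view s γ = mk⇔ (λ (e , δγ) → δγ , col-swap (trans e (col-swap δγ)))
                        (λ (δγ , δ′γ) → trans (col-unswap δ′γ) (sym (col-swap δγ)) , δγ)

  InProd-at : ∀ {α β r s} → col α β ≡ r →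
    ∀ t → InProd 𝒳 r s t ⇔ (∃ λ γ → col β γ ≡ s × col α γ ≡ t)
  InProd-at {α} {β} {r} {s} αβ t = mk⇔ to from
    where
    to : InProd 𝒳 r s t → ∃ λ γ → col β γ ≡ s × col α γ ≡ t
    to t∈rs with surj t
    ... | a , b , ab with t∈rs a b ab
    ... | c , ac , cb with coherent-∃ (trans ac (sym αβ)) ab cb
    ... | δ , αδ , βδ = δ , βδ , αδ
    from : (∃ λ γ → col β γ ≡ s × col α γ ≡ t) → InProd 𝒳 r s t
    from (δ , βδ , αδ) a b ab with coherent-∃ (trans αδ (sym ab)) αβ (col-swap βδ)
    ... | γ , aγ , bγ = γ , aγ , col-unswap bγ

  Separates : Point → Point → Fin m → Set
  Separates α β s = ∀ {γ γ′} → col β γ ≡ s → col β γ′ ≡ s → col α γ ≡ col α γ′ → γ ≡ γ′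

  separating⇒prodSize≡valency : ∀ {α β r s} → col α β ≡ r → Separates α β s →
    prodSize 𝒳 r s ≡ valency 𝒳 s
  separating⇒prodSize≡valency {α} {β} {r} {s} αβ separates = begin
    prodSize 𝒳 r s              ≡⟨ count-cong (inProd? 𝒳 r s) image? (InProd-at αβ) ⟩
    count image?                ≡⟨ count-image (λ γ → col β γ ≟ s) (col α) separates ⟩
    count (λ γ → col β γ ≟ s)   ≡⟨ valency-at β s ⟩
    valency 𝒳 s                 ∎
    where
    open ≡-Reasoning
    image? : Decidable (λ t → ∃ λ γ → col β γ ≡ s × col α γ ≡ t)
    image? t = any? λ γ → (col β γ ≟ s) ×-dec (col α γ ≟ t)

  _∼?_ : ∀ x y → Dec (_∼_ 𝒳 x y)
  x ∼? y = prodSize 𝒳 (star x) y ℕ≟ maxValency 𝒳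

  ∈Sk⇒valency≡maxValency : ∀ {s} → s ∈ Sk 𝒳 → valency 𝒳 s ≡ maxValency 𝒳
  ∈Sk⇒valency≡maxValency {s} s∈Sk = toWitness (Equivalence.from T-≡
    (trans (sym (lookup∘tabulate (λ s → ⌊ valency 𝒳 s ℕ≟ maxValency 𝒳 ⌋) s)) ([]=⇒lookup s∈Sk)))

  ∉N⇒non-neighbour : ∀ Y {x} → ¬ InN 𝒳 Y x → x ∈ Sk 𝒳 → ∃ λ y → y ∈ Y × ¬ _∼_ 𝒳 x y
  ∉N⇒non-neighbour Y {x} x∉N x∈Sk with any? (λ y → (y ∈? Y) ×-dec ¬? (x ∼? y))
  ... | yes w    = w
  ... | no  none = contradiction
    (x∈Sk , λ y y∈Y → decidable-stable (x ∼? y) λ x≁y → none (y , y∈Y , x≁y)) x∉N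

  -- Non-neighbours of a relation of maximal valency

  module NonNeighbours (y : Fin m) (y∈Sk : valency 𝒳 y ≡ maxValency 𝒳) where

    β : Point
    β = proj₁ (∃-in y zero)

    βy : col β zero ≡ y
    βy = proj₂ (∃-in y zero)

    Confuses : Pred Point 0ℓ
    Confuses α = ∃ λ δ → (col β δ ≡ y × δ ≢ zero) × col α δ ≡ col α zero

    others? : Decidable (λ δ → col β δ ≡ y × δ ≢ zero)
    others? δ = (col β δ ≟ y) ×-dec ¬? (δ ≟ zero)

    confuses? : Decidable Confuses
    confuses? α = any? λ δ → others? δ ×-dec (col α δ ≟ col α zero)

    count-others : count others? ≡ maxValency 𝒳 ∸ 1
    count-others = cong (_∸ 1)
      (trans (sym (count-remove (λ δ → col β δ ≟ y) βy)) (trans (valency-at β y) y∈Sk))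

    count-confuses : count confuses? ≤ indist 𝒳 * (maxValency 𝒳 ∸ 1)
    count-confuses = subst (count confuses? ≤_)
      (trans (cong (_* indist 𝒳) count-others) (*-comm (maxValency 𝒳 ∸ 1) (indist 𝒳)))
      (count-⋃≤ others? (λ δ α → col α δ ≟ col α zero) λ (_ , δ≢0) → confusions≤indist (δ≢0 ∘ sym))

    unconfused⇒∼ : ∀ x → (∀ {α} → col β α ≡ x → ¬ Confuses α) → _∼_ 𝒳 x y
    unconfused⇒∼ x unconfused = trans (separating⇒prodSize≡valency (col-swap βα₀) separates) y∈Sk
      where
      α₀ : Point
      α₀ = proj₁ (∃-out x β)
      βα₀ : col β α₀ ≡ x
      βα₀ = proj₂ (∃-out x β)

      only-zero : ∀ {α δ} → col β α ≡ x → col β δ ≡ y → col α δ ≡ col α zero → δ ≡ zero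
      only-zero {α} {δ} βα βδ same with δ ≟ zero
      ... | yes δ≡0 = δ≡0
      ... | no  δ≢0 = contradiction (δ , (βδ , δ≢0) , same) (unconfused βα)

      -- δ₁ and δ₂ lie in the fibre {δ ∈ βy : col α₀ δ = t}; coherence moves this fibre to a
      -- point α′ ∈ βx with col α′ 0 = t, where only-zero leaves room for 0 alone.
      separates : Separates α₀ β y
      separates {δ₁} {δ₂} βδ₁ βδ₂ same with coherent-∃ (trans βδ₁ (sym βy)) βα₀ (col-swap refl)
      ... | α′ , βα′ , α′0 = count≤1⇒unique (fibre? α₀) fibre-α₀≤1
                               (refl , trans βδ₁ (sym (star-involutive y)))
                               (sym same , trans βδ₂ (sym (star-involutive y)))
        where
        t : Fin m
        t = col α₀ δ₁
        fibre? : ∀ α → Decidable (λ δ → col α δ ≡ t × col β δ ≡ star (star y))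
        fibre? α δ = (col α δ ≟ t) ×-dec (col β δ ≟ star (star y))
        in-fibre⇒zero : ∀ {δ} → col α′ δ ≡ t × col β δ ≡ star (star y) → δ ≡ zero
        in-fibre⇒zero (α′δ , βδ) =
          only-zero βα′ (trans βδ (star-involutive y)) (trans α′δ (sym (col-unswap α′0)))
        fibre-α₀≤1 : cnt t (star y) α₀ β ≤ 1
        fibre-α₀≤1 =
          subst (_≤ 1) (coherent t (star y) α′ β α₀ β (trans (col-swap βα′) (sym (col-swap βα₀))))
          (unique⇒count≤1 (fibre? α′) λ p q → trans (in-fibre⇒zero p) (sym (in-fibre⇒zero q)))

    non-neighbours≤ : count (λ x → ¬? (x ∼? y)) ≤ indist 𝒳 * (maxValency 𝒳 ∸ 1)
    non-neighbours≤ =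
      ≤-trans (count-≤-cover (λ x → ¬? (x ∼? y)) confuses? (col β) witness) count-confuses
      where
      witness : ∀ {x} → ¬ _∼_ 𝒳 x y → ∃ λ α → Confuses α × col β α ≡ x
      witness {x} x≁y with any? (λ α → confuses? α ×-dec (col β α ≟ x))
      ... | yes w    = w
      ... | no  none = contradiction (unconfused⇒∼ x λ βα c → none (_ , c , βα)) x≁y

lemma5p2 : ∀ {n m : ℕ} (𝒳 : HomCC n m) (Y : Subset m) → Y ⊆ Sk 𝒳 →
    ∣ Sk 𝒳 ∣ ≤ sizeN 𝒳 Y + indist 𝒳 * (maxValency 𝒳 ∸ 1) * ∣ Y ∣
lemma5p2 𝒳 Y Y⊆Sk = begin
  ∣ Sk 𝒳 ∣
    ≡⟨ trans (∣p∣≡count (Sk 𝒳)) (count-split (_∈? Sk 𝒳) (inN? 𝒳 Y)) ⟩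
  count (λ x → (x ∈? Sk 𝒳) ×-dec inN? 𝒳 Y x) + count (λ x → (x ∈? Sk 𝒳) ×-dec ¬? (inN? 𝒳 Y x))
    ≤⟨ +-mono-≤ (count-mono _ (inN? 𝒳 Y) proj₂)
                (count-mono _ non-neighbour? λ (x∈Sk , x∉N) → ∉N⇒non-neighbour 𝒳 Y x∉N x∈Sk) ⟩
  sizeN 𝒳 Y + count non-neighbour?
    ≤⟨ +-monoʳ-≤ (sizeN 𝒳 Y) (count-⋃≤ (_∈? Y) (λ y x → ¬? (_∼?_ 𝒳 x y)) λ y∈Y →
         NonNeighbours.non-neighbours≤ 𝒳 _ (∈Sk⇒valency≡maxValency 𝒳 (Y⊆Sk y∈Y))) ⟩
  sizeN 𝒳 Y + count (_∈? Y) * (c * (k ∸ 1))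
    ≡⟨ cong (sizeN 𝒳 Y +_) (trans (cong (_* (c * (k ∸ 1))) (sym (∣p∣≡count Y)))
                                  (*-comm ∣ Y ∣ (c * (k ∸ 1)))) ⟩
  sizeN 𝒳 Y + c * (k ∸ 1) * ∣ Y ∣ ∎
  where
  open ≤-Reasoning
  k c : ℕ
  k = maxValency 𝒳
  c = indist 𝒳
  non-neighbour? : Decidable (λ x → ∃ λ y → y ∈ Y × ¬ _∼_ 𝒳 x y)
  non-neighbour? x = any? λ y → (y ∈? Y) ×-dec ¬? (_∼?_ 𝒳 x y)
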